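{- Let $n,r,v\in\mathbb{N}_0$. Then \[ \int_{\mathbb{Z}_p} x^{v}\binom{x}{n}^{r}d\mu_1(x)=\sum_{k=0}^{nr}\sum_{j=0}^{k}(-1)^j\binom{k}{j}\binom{k-j}{n}^{r}\sum_{l=0}^{k}\frac{S_1(k,l)B_{v+l}}{k!}. \]
   Context: $p$ is an odd prime. For a polynomial $f:\mathbb{Z}_p\to\mathbb{C}_p$ the Volkenborn integral is $\int_{\mathbb{Z}_p} f(x)\,d\mu_1(x)=\lim_{N\to\infty}p^{ -N}\sum_{x=0}^{p^N-1}f(x)$. $\binom{x}{n}=x(x-1)\cdots(x-n+1)/n!$ (and $\binom{a}{n}=0$ for integers $0\le a<n$). The Stirling numbers of the first kind $S_1(k,l)$ are defined by $x(x-1)\cdots(x-k+1)=\sum_{l=0}^k S_1(k,l)x^l$. The Bernoulli numbers $B_m$ are defined by $\frac{t}{e^t-1}=\sum_{m\ge0}B_m\frac{t^m}{m!}$. -}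

module Defs where

open import Data.Nat as ℕ using (ℕ; zero; suc; _≤_; NonZero)
open import Data.Nat.Properties using (m^n≢0; _!≢0)
open import Data.Nat.Combinatorics using (_C_)
open import Data.Nat.Primality using (Prime; prime⇒nonZero)
open import Data.Integer as ℤ using (ℤ; +_)
open import Data.Integer.Divisibility as ℤDiv using ()
open import Data.Rational as ℚ using (ℚ; _/_)
open import Data.List using (List; []; _∷_; _++_; length)
open import Data.Product using (Σ; ∃; _×_; _,_)
open import Relation.Nullary using (¬_)
open import Relation.Binary.PropositionalEquality using (_≡_)

sumℕ : ℕ → (ℕ → ℕ) → ℕ
sumℕ zero    f = 0
sumℕ (suc n) f = sumℕ n f ℕ.+ f n

sumℚ : ℕ → (ℕ → ℚ) → ℚ
sumℚ zero    f = ℚ.0ℚ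
sumℚ (suc n) f = sumℚ n f ℚ.+ f n

sumℚ≤ : ℕ → (ℕ → ℚ) → ℚ
sumℚ≤ b f = sumℚ (suc b) f

ℕtoℚ : ℕ → ℚ
ℕtoℚ n = (+ n) / 1

ℤtoℚ : ℤ → ℚ
ℤtoℚ z = z / 1

nth : {A : Set} → A → List A → ℕ → A
nth d []       _       = d
nth d (x ∷ xs) zero    = x
nth d (x ∷ xs) (suc i) = nth d xs i

-- Stirling numbers of the first kind (signed), as the coefficients of
-- the falling factorial  x(x-1)...(x-k+1) = Σ_l S₁(k,l) x^l.

-- integer polynomials as coefficient lists (lowest degree first)
Poly : Set
Poly = List ℤ

mulXminus : ℤ → Poly → Poly
mulXminus c p = go (+ 0) p
  where
  -- prev = coefficient of x^{i-1} in p; output coeff of x^i is prev - c·p_i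
  go : ℤ → Poly → Poly
  go prev []       = prev ∷ []
  go prev (a ∷ as) = (prev ℤ.- c ℤ.* a) ∷ go a as

fallingPoly : ℕ → Poly
fallingPoly zero    = + 1 ∷ []
fallingPoly (suc k) = mulXminus (+ k) (fallingPoly k)

S₁ : ℕ → ℕ → ℤ
S₁ k l = nth (+ 0) (fallingPoly k) l

-- Bernoulli numbers, t/(e^t - 1) = Σ B_m t^m/m!  (so B₁ = -1/2),
-- via the equivalent recursion Σ_{j=0}^{m} C(m+1,j) B_j = [m = 0].

isZero : ℕ → ℚ
isZero zero    = ℚ.1ℚ
isZero (suc _) = ℚ.0ℚ

bernoulliList : ℕ → List ℚ
bernoulliList zero    = []
bernoulliList (suc m) = bs ++ (next ∷ [])
  where
  bs : List ℚ
  bs = bernoulliList m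
  next : ℚ
  δ : ℚ
  δ = isZero m
  next = ((+ 1) / suc m) ℚ.*
           (δ ℚ.- sumℚ m (λ j → ℕtoℚ (suc m C j) ℚ.* nth ℚ.0ℚ bs j))

B : ℕ → ℚ
B m = nth ℚ.0ℚ (bernoulliList (suc m)) m

-- p-adic closeness in ℚ: q ∈ p^k ℤ_(p), i.e. |q|_p ≤ p^{-k}.

InPowZp : ℕ → ℕ → ℚ → Set
InPowZp p k q = ∃ λ (a : ℤ) → ∃ λ (b : ℤ) →
  (¬ ((+ p) ℤDiv.∣ b)) × (q ℚ.* ℤtoℚ b ≡ ℤtoℚ ((+ (p ℕ.^ k)) ℤ.* a))

riemannSum : (p : ℕ) → Prime p → ℕ → (ℕ → ℕ) → ℚ
riemannSum p pp N f = ((+ sumℕ (p ℕ.^ N) f) / (p ℕ.^ N)) {{m^n≢0 p N {{prime⇒nonZero pp}}}}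

VolkenbornIntegralEq : (p : ℕ) → Prime p → (ℕ → ℕ) → ℚ → Set
VolkenbornIntegralEq p pp f L =
  ∀ (k : ℕ) → ∃ λ (N₀ : ℕ) → ∀ (N : ℕ) → N₀ ≤ N →
    InPowZp p k (riemannSum p pp N f ℚ.- L)

invFact : ℕ → ℚ
invFact k = ((+ 1) / (k ℕ.!)) {{k !≢0}}

rhs5 : ℕ → ℕ → ℕ → ℚ
rhs5 n r v =
  sumℚ≤ (n ℕ.* r) λ k →
    sumℚ≤ k λ j →
      ℤtoℚ ((ℤ.- (+ 1)) ℤ.^ j) ℚ.* ℕtoℚ (k C j) ℚ.* ℕtoℚ (((k ℕ.∸ j) C n) ℕ.^ r)
      ℚ.* sumℚ≤ k (λ l → ℤtoℚ (S₁ k l) ℚ.* B (v ℕ.+ l) ℚ.* invFact k)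

{-# OPTIONS --safe #-}
module Submission where

-- Newton's forward-difference formula writes the degree-nr polynomial (x C n)^r as
-- Σ_k (x C k) Δ^k[(· C n)^r](0), where the k-th difference at 0 is the alternating sum over j;
-- expanding (x C k) = Σ_l S₁(k,l) x^l / k! turns the integrand into a rational combination of
-- monomials x^(v+l). The Riemann sums are linear, so it remains to show ∫ x^m = B_m. Telescoping
-- Σ_{x<M} ((x+1)^(m+1) − x^(m+1)) = M^(m+1) shows that the Riemann sums T_j(N) of x^j satisfy
-- Σ_{j≤m} C(m+1,j) T_j(N) = p^(Nm), which tends p-adically to [m = 0]; this is the recurrence
-- defining the B_j, and solving the triangular system row by row gives T_m(N) → B_m.

-- Scoped so that _+_ and _*_ denote ℚ operations here, but ℕ ones in the theorem statement.
module _ where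
  open import Defs
  open import Data.Nat as ℕ using (ℕ; zero; suc; NonZero; _<_; _≤_; _∸_; _⊔_; _!)
  import Data.Nat.Properties as ℕP
  open import Data.Nat.Combinatorics using (_C_; nCk+nC[k+1]≡[n+1]C[k+1]; nCk≡nC[n∸k]; nC1≡n; nCn≡1)
  open import Data.Nat.Combinatorics.Specification using (k>n⇒nCk≡0)
  open import Data.Nat.Divisibility using (_∣_; _∣?_; quotient; quotient-<; quotient≢0; ∣1⇒≡1)
  open import Data.Nat.Induction using (<-rec; <-wellFounded)
  open import Data.Nat.Primality using (Prime; euclidsLemma; prime⇒nonZero; prime⇒nonTrivial)
  open import Data.Integer as ℤ using (ℤ; +_)
  import Data.Integer.Properties as ℤP
  import Data.Integer.Divisibility as ℤDiv
  open import Data.Rational as ℚ using (ℚ; 0ℚ; 1ℚ; _+_; _*_; _-_; -_; _/_; toℚᵘ; ↥_; ↧_)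
  import Data.Rational.Properties as ℚP
  open import Data.Rational.Unnormalised as ℚᵘ using (mkℚᵘ; *≡*) renaming (_≃_ to _≃ᵘ_)
  import Data.Rational.Unnormalised.Properties as ℚᵘP
  open import Data.List using ([]; _∷_; length; _++_)
  open import Data.List.Properties using (length-++)
  open import Data.Product using (∃; _×_; _,_)
  open import Data.Sum using (inj₁; inj₂)
  open import Induction.WellFounded using (Acc; acc)
  open import Relation.Nullary using (¬_; yes; no)
  open import Relation.Binary.PropositionalEquality
  import Data.Rational.Solver
  import Data.Integer.Solver
  import Data.Nat.Solver
  module ℚ-Solver = Data.Rational.Solver.+-*-Solver
  module ℤ-Solver = Data.Integer.Solver.+-*-Solver
  module ℕ-Solver = Data.Nat.Solver.+-*-Solver

  toℚᵘ-/ : ∀ i d → toℚᵘ (i / suc d) ≃ᵘ mkℚᵘ i d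
  toℚᵘ-/ i d = ℚP.toℚᵘ-fromℚᵘ (mkℚᵘ i d)

  ℤtoℚ-+ : ∀ a b → ℤtoℚ (a ℤ.+ b) ≡ ℤtoℚ a + ℤtoℚ b
  ℤtoℚ-+ a b = ℚP.toℚᵘ-injective (begin
    toℚᵘ (ℤtoℚ (a ℤ.+ b))               ≈⟨ toℚᵘ-/ (a ℤ.+ b) 0 ⟩
    mkℚᵘ (a ℤ.+ b) 0                    ≈⟨ *≡* (solve 2 (λ a b → (a :+ b) :* con (+ 1) := (a :* con (+ 1) :+ b :* con (+ 1)) :* con (+ 1)) refl a b) ⟩
    mkℚᵘ a 0 ℚᵘ.+ mkℚᵘ b 0              ≈⟨ ℚᵘP.+-cong (toℚᵘ-/ a 0) (toℚᵘ-/ b 0) ⟨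
    toℚᵘ (ℤtoℚ a) ℚᵘ.+ toℚᵘ (ℤtoℚ b)    ≈⟨ ℚP.toℚᵘ-homo-+ (ℤtoℚ a) (ℤtoℚ b) ⟨
    toℚᵘ (ℤtoℚ a + ℤtoℚ b)              ∎)
    where
    open ℚᵘP.≃-Reasoning
    open ℤ-Solver

  ℤtoℚ-* : ∀ a b → ℤtoℚ (a ℤ.* b) ≡ ℤtoℚ a * ℤtoℚ b
  ℤtoℚ-* a b = ℚP.toℚᵘ-injective (begin
    toℚᵘ (ℤtoℚ (a ℤ.* b))               ≈⟨ toℚᵘ-/ (a ℤ.* b) 0 ⟩
    mkℚᵘ (a ℤ.* b) 0                    ≈⟨ ℚᵘP.*-cong (toℚᵘ-/ a 0) (toℚᵘ-/ b 0) ⟨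
    toℚᵘ (ℤtoℚ a) ℚᵘ.* toℚᵘ (ℤtoℚ b)    ≈⟨ ℚP.toℚᵘ-homo-* (ℤtoℚ a) (ℤtoℚ b) ⟨
    toℚᵘ (ℤtoℚ a * ℤtoℚ b)              ∎)
    where open ℚᵘP.≃-Reasoning

  ℤtoℚ-neg : ∀ a → ℤtoℚ (ℤ.- a) ≡ - ℤtoℚ a
  ℤtoℚ-neg a = ℚP.toℚᵘ-injective (begin
    toℚᵘ (ℤtoℚ (ℤ.- a))    ≈⟨ toℚᵘ-/ (ℤ.- a) 0 ⟩
    mkℚᵘ (ℤ.- a) 0         ≈⟨ ℚᵘP.-‿cong (toℚᵘ-/ a 0) ⟨
    ℚᵘ.- toℚᵘ (ℤtoℚ a)     ≈⟨ ℚP.toℚᵘ-homo‿- (ℤtoℚ a) ⟨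
    toℚᵘ (- ℤtoℚ a)        ∎)
    where open ℚᵘP.≃-Reasoning

  ℕtoℚ-+ : ∀ a b → ℕtoℚ (a ℕ.+ b) ≡ ℕtoℚ a + ℕtoℚ b
  ℕtoℚ-+ a b = trans (cong ℤtoℚ (ℤP.pos-+ a b)) (ℤtoℚ-+ (+ a) (+ b))

  ℕtoℚ-* : ∀ a b → ℕtoℚ (a ℕ.* b) ≡ ℕtoℚ a * ℕtoℚ b
  ℕtoℚ-* a b = trans (cong ℤtoℚ (ℤP.pos-* a b)) (ℤtoℚ-* (+ a) (+ b))

  ℕtoℚ-suc : ∀ n → ℕtoℚ (suc n) ≡ ℕtoℚ n + 1ℚ
  ℕtoℚ-suc n = trans (ℕtoℚ-+ 1 n) (ℚP.+-comm 1ℚ (ℕtoℚ n))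

  /-as-* : ∀ i d .{{_ : NonZero d}} → i / d ≡ ℤtoℚ i * (+ 1 / d)
  /-as-* i (suc d) = ℚP.toℚᵘ-injective (begin
    toℚᵘ (i / suc d)                               ≈⟨ toℚᵘ-/ i d ⟩
    mkℚᵘ i d                                       ≈⟨ *≡* (solve 2 (λ i e → i :* (con (+ 1) :* e) := (i :* con (+ 1)) :* e) refl i (+ suc d)) ⟩
    mkℚᵘ i 0 ℚᵘ.* mkℚᵘ (+ 1) d                     ≈⟨ ℚᵘP.*-cong (toℚᵘ-/ i 0) (toℚᵘ-/ (+ 1) d) ⟨
    toℚᵘ (ℤtoℚ i) ℚᵘ.* toℚᵘ (+ 1 / suc d)          ≈⟨ ℚP.toℚᵘ-homo-* (ℤtoℚ i) (+ 1 / suc d) ⟨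
    toℚᵘ (ℤtoℚ i * (+ 1 / suc d))                  ∎)
    where
    open ℚᵘP.≃-Reasoning
    open ℤ-Solver

  1/n*n≡1 : ∀ n .{{_ : NonZero n}} → (+ 1 / n) * ℕtoℚ n ≡ 1ℚ
  1/n*n≡1 (suc d) = ℚP.toℚᵘ-injective (begin
    toℚᵘ ((+ 1 / suc d) * ℕtoℚ (suc d))                 ≈⟨ ℚP.toℚᵘ-homo-* (+ 1 / suc d) (ℕtoℚ (suc d)) ⟩
    toℚᵘ (+ 1 / suc d) ℚᵘ.* toℚᵘ (ℕtoℚ (suc d))         ≈⟨ ℚᵘP.*-cong (toℚᵘ-/ (+ 1) d) (toℚᵘ-/ (+ suc d) 0) ⟩
    mkℚᵘ (+ 1) d ℚᵘ.* mkℚᵘ (+ suc d) 0                   ≈⟨ *≡* (solve 1 (λ e → (con (+ 1) :* e) :* con (+ 1) := con (+ 1) :* (e :* con (+ 1))) refl (+ suc d)) ⟩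
    ℚᵘ.1ℚᵘ                                               ∎)
    where
    open ℚᵘP.≃-Reasoning
    open ℤ-Solver

  *-cancelʳ-ℕtoℚ : ∀ x y m .{{_ : NonZero m}} → x * ℕtoℚ m ≡ y * ℕtoℚ m → x ≡ y
  *-cancelʳ-ℕtoℚ x y m eq = begin
    x                              ≡⟨ ℚP.*-identityʳ x ⟨
    x * 1ℚ                         ≡⟨ cong (x *_) inv ⟨
    x * (ℕtoℚ m * (+ 1 / m))       ≡⟨ ℚP.*-assoc x (ℕtoℚ m) (+ 1 / m) ⟨
    x * ℕtoℚ m * (+ 1 / m)         ≡⟨ cong (_* (+ 1 / m)) eq ⟩
    y * ℕtoℚ m * (+ 1 / m)         ≡⟨ ℚP.*-assoc y (ℕtoℚ m) (+ 1 / m) ⟩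
    y * (ℕtoℚ m * (+ 1 / m))       ≡⟨ cong (y *_) inv ⟩
    y * 1ℚ                         ≡⟨ ℚP.*-identityʳ y ⟩
    y                              ∎
    where
    open ≡-Reasoning
    inv : ℕtoℚ m * (+ 1 / m) ≡ 1ℚ
    inv = trans (ℚP.*-comm (ℕtoℚ m) (+ 1 / m)) (1/n*n≡1 m)

  *-↧≡↥ : ∀ c → c * ℤtoℚ (↧ c) ≡ ℤtoℚ (↥ c)
  *-↧≡↥ c@(ℚ.mkℚ n d _) = ℚP.toℚᵘ-injective (begin
    toℚᵘ (c * ℤtoℚ (↧ c))                 ≈⟨ ℚP.toℚᵘ-homo-* c (ℤtoℚ (↧ c)) ⟩
    toℚᵘ c ℚᵘ.* toℚᵘ (ℤtoℚ (↧ c))         ≈⟨ ℚᵘP.*-congˡ {toℚᵘ c} (toℚᵘ-/ (↧ c) 0) ⟩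
    toℚᵘ c ℚᵘ.* mkℚᵘ (↧ c) 0              ≈⟨ *≡* (solve 2 (λ n e → (n :* e) :* con (+ 1) := n :* (e :* con (+ 1))) refl n (+ suc d)) ⟩
    mkℚᵘ n 0                              ≈⟨ toℚᵘ-/ n 0 ⟨
    toℚᵘ (ℤtoℚ (↥ c))                     ∎)
    where
    open ℚᵘP.≃-Reasoning
    open ℤ-Solver

  open ≡-Reasoning

  sumℚ-cong : ∀ n {f g : ℕ → ℚ} → (∀ i → i < n → f i ≡ g i) → sumℚ n f ≡ sumℚ n g
  sumℚ-cong zero    eq = refl
  sumℚ-cong (suc n) eq = cong₂ _+_ (sumℚ-cong n (λ i i<n → eq i (ℕP.m<n⇒m<1+n i<n))) (eq n (ℕP.n<1+n n))

  sumℚ-zero : ∀ n → sumℚ n (λ _ → 0ℚ) ≡ 0ℚ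
  sumℚ-zero zero    = refl
  sumℚ-zero (suc n) = cong (_+ 0ℚ) (sumℚ-zero n)

  sumℚ-+ : ∀ n (f g : ℕ → ℚ) → sumℚ n (λ i → f i + g i) ≡ sumℚ n f + sumℚ n g
  sumℚ-+ zero    f g = refl
  sumℚ-+ (suc n) f g = begin
    sumℚ n (λ i → f i + g i) + (f n + g n)  ≡⟨ cong (_+ (f n + g n)) (sumℚ-+ n f g) ⟩
    (sumℚ n f + sumℚ n g) + (f n + g n)     ≡⟨ solve 4 (λ a b c d → (a :+ b) :+ (c :+ d) := (a :+ c) :+ (b :+ d)) refl (sumℚ n f) (sumℚ n g) (f n) (g n) ⟩
    (sumℚ n f + f n) + (sumℚ n g + g n)     ∎
    where open ℚ-Solver

  sumℚ-- : ∀ n (f g : ℕ → ℚ) → sumℚ n (λ i → f i - g i) ≡ sumℚ n f - sumℚ n g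
  sumℚ-- zero    f g = refl
  sumℚ-- (suc n) f g = begin
    sumℚ n (λ i → f i - g i) + (f n - g n)  ≡⟨ cong (_+ (f n - g n)) (sumℚ-- n f g) ⟩
    (sumℚ n f - sumℚ n g) + (f n - g n)     ≡⟨ solve 4 (λ a b c d → (a :- b) :+ (c :- d) := (a :+ c) :- (b :+ d)) refl (sumℚ n f) (sumℚ n g) (f n) (g n) ⟩
    (sumℚ n f + f n) - (sumℚ n g + g n)     ∎
    where open ℚ-Solver

  sumℚ-*ˡ : ∀ n c (f : ℕ → ℚ) → sumℚ n (λ i → c * f i) ≡ c * sumℚ n f
  sumℚ-*ˡ zero    c f = sym (ℚP.*-zeroʳ c)
  sumℚ-*ˡ (suc n) c f = trans (cong (_+ c * f n) (sumℚ-*ˡ n c f)) (sym (ℚP.*-distribˡ-+ c (sumℚ n f) (f n)))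

  sumℚ-*ʳ : ∀ n c (f : ℕ → ℚ) → sumℚ n (λ i → f i * c) ≡ sumℚ n f * c
  sumℚ-*ʳ n c f = begin
    sumℚ n (λ i → f i * c)  ≡⟨ sumℚ-cong n (λ i _ → ℚP.*-comm (f i) c) ⟩
    sumℚ n (λ i → c * f i)  ≡⟨ sumℚ-*ˡ n c f ⟩
    c * sumℚ n f            ≡⟨ ℚP.*-comm c (sumℚ n f) ⟩
    sumℚ n f * c            ∎

  sumℚ-neg : ∀ n (f : ℕ → ℚ) → sumℚ n (λ i → - f i) ≡ - sumℚ n f
  sumℚ-neg zero    f = refl
  sumℚ-neg (suc n) f = trans (cong (_+ - f n) (sumℚ-neg n f)) (sym (ℚP.neg-distrib-+ (sumℚ n f) (f n)))

  sumℚ-suc : ∀ n (f : ℕ → ℚ) → sumℚ (suc n) f ≡ f 0 + sumℚ n (λ i → f (suc i))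
  sumℚ-suc zero    f = trans (ℚP.+-identityˡ (f 0)) (sym (ℚP.+-identityʳ (f 0)))
  sumℚ-suc (suc n) f = trans (cong (_+ f (suc n)) (sumℚ-suc n f)) (ℚP.+-assoc (f 0) _ _)

  sumℚ-dropLast : ∀ n (f : ℕ → ℚ) → f n ≡ 0ℚ → sumℚ (suc n) f ≡ sumℚ n f
  sumℚ-dropLast n f fn≡0 = trans (cong (λ t → sumℚ n f + t) fn≡0) (ℚP.+-identityʳ (sumℚ n f))

  sumℚ-swap : ∀ n m (f : ℕ → ℕ → ℚ) →
              sumℚ n (λ i → sumℚ m (λ j → f i j)) ≡ sumℚ m (λ j → sumℚ n (λ i → f i j))
  sumℚ-swap zero    m f = sym (sumℚ-zero m)
  sumℚ-swap (suc n) m f = begin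
    sumℚ n (λ i → sumℚ m (f i)) + sumℚ m (f n)              ≡⟨ cong (_+ sumℚ m (f n)) (sumℚ-swap n m f) ⟩
    sumℚ m (λ j → sumℚ n (λ i → f i j)) + sumℚ m (f n)      ≡⟨ sumℚ-+ m (λ j → sumℚ n (λ i → f i j)) (f n) ⟨
    sumℚ m (λ j → sumℚ (suc n) (λ i → f i j))               ∎

  sumℚ-telescope : ∀ n (g : ℕ → ℚ) → sumℚ n (λ i → g (suc i) - g i) ≡ g n - g 0
  sumℚ-telescope zero    g = sym (ℚP.+-inverseʳ (g 0))
  sumℚ-telescope (suc n) g = begin
    sumℚ n (λ i → g (suc i) - g i) + (g (suc n) - g n)  ≡⟨ cong (_+ (g (suc n) - g n)) (sumℚ-telescope n g) ⟩
    (g n - g 0) + (g (suc n) - g n)                     ≡⟨ solve 3 (λ a b c → (b :- a) :+ (c :- b) := c :- a) refl (g 0) (g n) (g (suc n)) ⟩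
    g (suc n) - g 0                                     ∎
    where open ℚ-Solver

  ℕtoℚ-sumℕ : ∀ n (f : ℕ → ℕ) → ℕtoℚ (sumℕ n f) ≡ sumℚ n (λ i → ℕtoℚ (f i))
  ℕtoℚ-sumℕ zero    f = refl
  ℕtoℚ-sumℕ (suc n) f = trans (ℕtoℚ-+ (sumℕ n f) (f n)) (cong (_+ ℕtoℚ (f n)) (ℕtoℚ-sumℕ n f))

  ℕtoℚ-pascal : ∀ x k → ℕtoℚ (suc x C suc k) ≡ ℕtoℚ (x C k) + ℕtoℚ (x C suc k)
  ℕtoℚ-pascal x k = trans (cong ℕtoℚ (sym (nCk+nC[k+1]≡[n+1]C[k+1] x k))) (ℕtoℚ-+ (x C k) (x C suc k))

  Δ : (ℕ → ℚ) → ℕ → ℚ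
  Δ g x = g (suc x) - g x

  Δ^ : ℕ → (ℕ → ℚ) → ℕ → ℚ
  Δ^ zero    g = g
  Δ^ (suc k) g = Δ^ k (Δ g)

  Δ^-cong : ∀ k {g h : ℕ → ℚ} → (∀ x → g x ≡ h x) → ∀ y → Δ^ k g y ≡ Δ^ k h y
  Δ^-cong zero    eq y = eq y
  Δ^-cong (suc k) eq y = Δ^-cong k (λ x → cong₂ _-_ (eq (suc x)) (eq x)) y

  Δ^-shift : ∀ k (g : ℕ → ℚ) y → Δ^ k (λ x → g (suc x)) y ≡ Δ^ k g (suc y)
  Δ^-shift zero    g y = refl
  Δ^-shift (suc k) g y = Δ^-shift k (Δ g) y

  Δ^-+ : ∀ k (g h : ℕ → ℚ) y → Δ^ k (λ x → g x + h x) y ≡ Δ^ k g y + Δ^ k h y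
  Δ^-+ zero    g h y = refl
  Δ^-+ (suc k) g h y = trans (Δ^-cong k regroup y) (Δ^-+ k (Δ g) (Δ h) y)
    where
    open ℚ-Solver
    regroup : ∀ x → Δ (λ x → g x + h x) x ≡ Δ g x + Δ h x
    regroup x = solve 4 (λ a b c d → (a :+ b) :- (c :+ d) := (a :- c) :+ (b :- d)) refl (g (suc x)) (h (suc x)) (g x) (h x)

  Δ^-- : ∀ k (g h : ℕ → ℚ) y → Δ^ k (λ x → g x - h x) y ≡ Δ^ k g y - Δ^ k h y
  Δ^-- zero    g h y = refl
  Δ^-- (suc k) g h y = trans (Δ^-cong k regroup y) (Δ^-- k (Δ g) (Δ h) y)
    where
    open ℚ-Solver
    regroup : ∀ x → Δ (λ x → g x - h x) x ≡ Δ g x - Δ h x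
    regroup x = solve 4 (λ a b c d → (a :- b) :- (c :- d) := (a :- c) :- (b :- d)) refl (g (suc x)) (h (suc x)) (g x) (h x)

  Δ^-suc : ∀ k (g : ℕ → ℚ) y → Δ^ (suc k) g y ≡ Δ^ k g (suc y) - Δ^ k g y
  Δ^-suc k g y = trans (Δ^-- k (λ x → g (suc x)) g y) (cong (_- Δ^ k g y) (Δ^-shift k g y))

  DegreeBelow : ℕ → (ℕ → ℚ) → Set
  DegreeBelow d g = ∀ y → Δ^ d g y ≡ 0ℚ

  degreeBelow-cong : ∀ d {g h} → (∀ x → g x ≡ h x) → DegreeBelow d g → DegreeBelow d h
  degreeBelow-cong d eq deg y = trans (sym (Δ^-cong d eq y)) (deg y)

  degreeBelow-zero : ∀ d {g} → (∀ x → g x ≡ 0ℚ) → DegreeBelow d g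
  degreeBelow-zero zero    g≡0 = g≡0
  degreeBelow-zero (suc d) g≡0 = degreeBelow-zero d (λ x → cong₂ _-_ (g≡0 (suc x)) (g≡0 x))

  degreeBelow-shift : ∀ d {g} → DegreeBelow d g → DegreeBelow d (λ x → g (suc x))
  degreeBelow-shift d {g} deg y = trans (Δ^-shift d g y) (deg (suc y))

  degreeBelow-const : ∀ c → DegreeBelow 1 (λ _ → c)
  degreeBelow-const c y = ℚP.+-inverseʳ c

  Δ-* : ∀ (g h : ℕ → ℚ) x → Δ (λ x → g x * h x) x ≡ Δ g x * h (suc x) + g x * Δ h x
  Δ-* g h x = solve 4 (λ a b c d → a :* b :- c :* d := (a :- c) :* b :+ c :* (b :- d)) refl (g (suc x)) (h (suc x)) (g x) (h x)
    where open ℚ-Solver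

  degreeBelow-* : ∀ a b {g h} → DegreeBelow (suc a) g → DegreeBelow (suc b) h →
                  DegreeBelow (suc (a ℕ.+ b)) (λ x → g x * h x)
  degreeBelow-* a b {g} {h} degg degh =
    degreeBelow-cong (a ℕ.+ b) (λ x → sym (Δ-* g h x))
      (λ y → trans (Δ^-+ (a ℕ.+ b) _ _ y) (cong₂ _+_ (left a degg y) (right b degh y)))
    where
    left : ∀ a → DegreeBelow (suc a) g → DegreeBelow (a ℕ.+ b) (λ x → Δ g x * h (suc x))
    left zero     degg = degreeBelow-zero b {λ x → Δ g x * h (suc x)} (λ x → trans (cong (_* h (suc x)) (degg x)) (ℚP.*-zeroˡ (h (suc x))))
    left (suc a') degg = degreeBelow-* a' b {Δ g} {λ x → h (suc x)} degg (degreeBelow-shift (suc b) {h} degh)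
    right : ∀ b → DegreeBelow (suc b) h → DegreeBelow (a ℕ.+ b) (λ x → g x * Δ h x)
    right zero     degh = degreeBelow-zero (a ℕ.+ 0) {λ x → g x * Δ h x} (λ x → trans (cong (g x *_) (degh x)) (ℚP.*-zeroʳ (g x)))
    right (suc b') degh = subst (λ d → DegreeBelow d (λ x → g x * Δ h x)) (sym (ℕP.+-suc a b'))
                                (degreeBelow-* a b' {g} {Δ h} degg degh)

  degreeBelow-C : ∀ n → DegreeBelow (suc n) (λ x → ℕtoℚ (x C n))
  degreeBelow-C zero    = degreeBelow-const 1ℚ
  degreeBelow-C (suc n) = degreeBelow-cong (suc n) ΔC≡C (degreeBelow-C n)
    where
    open ℚ-Solver
    ΔC≡C : ∀ x → ℕtoℚ (x C n) ≡ Δ (λ x → ℕtoℚ (x C suc n)) x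
    ΔC≡C x = sym (trans (cong (_- ℕtoℚ (x C suc n)) (ℕtoℚ-pascal x n))
                        (solve 2 (λ a b → (a :+ b) :- b := a) refl (ℕtoℚ (x C n)) (ℕtoℚ (x C suc n))))

  degreeBelow-C^ : ∀ n r → DegreeBelow (suc (n ℕ.* r)) (λ x → ℕtoℚ ((x C n) ℕ.^ r))
  degreeBelow-C^ n zero    = subst (λ d → DegreeBelow (suc d) (λ x → ℕtoℚ ((x C n) ℕ.^ 0))) (sym (ℕP.*-zeroʳ n)) (degreeBelow-const 1ℚ)
  degreeBelow-C^ n (suc r) = subst (λ d → DegreeBelow (suc d) (λ x → ℕtoℚ ((x C n) ℕ.^ suc r))) (sym (ℕP.*-suc n r))
    (degreeBelow-cong (suc (n ℕ.+ n ℕ.* r)) (λ x → sym (ℕtoℚ-* (x C n) _))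
      (degreeBelow-* n (n ℕ.* r) {λ x → ℕtoℚ (x C n)} {λ x → ℕtoℚ ((x C n) ℕ.^ r)} (degreeBelow-C n) (degreeBelow-C^ n r)))

  newton-forward : ∀ D (g : ℕ → ℚ) → DegreeBelow D g → ∀ x → g x ≡ sumℚ D (λ k → ℕtoℚ (x C k) * Δ^ k g 0)
  newton-forward zero    g deg x       = deg x
  newton-forward (suc D) g deg zero    = sym (begin
    sumℚ (suc D) (λ k → ℕtoℚ (0 C k) * Δ^ k g 0)               ≡⟨ sumℚ-suc D _ ⟩
    1ℚ * g 0 + sumℚ D (λ k → 0ℚ * Δ^ (suc k) g 0)             ≡⟨ cong (λ t → 1ℚ * g 0 + t) (trans (sumℚ-cong D (λ k _ → ℚP.*-zeroˡ (Δ^ (suc k) g 0))) (sumℚ-zero D)) ⟩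
    1ℚ * g 0 + 0ℚ                                             ≡⟨ solve 1 (λ a → con 1ℚ :* a :+ con 0ℚ := a) refl (g 0) ⟩
    g 0                                                       ∎)
    where open ℚ-Solver
  newton-forward (suc D) g deg (suc x) = begin
    g (suc x)                                              ≡⟨ solve 2 (λ a b → b := a :+ (b :- a)) refl (g x) (g (suc x)) ⟩
    g x + Δ g x                                            ≡⟨ cong₂ _+_ (newton-forward (suc D) g deg x) (newton-forward D (Δ g) deg x) ⟩
    sumℚ (suc D) (λ k → ℕtoℚ (x C k) * Δ^ k g 0) + Sₓ      ≡⟨ cong (_+ Sₓ) (sumℚ-suc D _) ⟩
    (1ℚ * g 0 + Sₓ₊) + Sₓ                                   ≡⟨ ℚP.+-assoc (1ℚ * g 0) Sₓ₊ Sₓ ⟩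
    1ℚ * g 0 + (Sₓ₊ + Sₓ)                                   ≡⟨ cong (λ t → 1ℚ * g 0 + t) (sumℚ-+ D _ _) ⟨
    1ℚ * g 0 + sumℚ D (λ k → ℕtoℚ (x C suc k) * d k + ℕtoℚ (x C k) * d k)
                                                           ≡⟨ cong (λ t → 1ℚ * g 0 + t) (sumℚ-cong D (λ k _ → pascal k)) ⟩
    1ℚ * g 0 + sumℚ D (λ k → ℕtoℚ (suc x C suc k) * d k)  ≡⟨ sumℚ-suc D _ ⟨
    sumℚ (suc D) (λ k → ℕtoℚ (suc x C k) * Δ^ k g 0)      ∎
    where
    open ℚ-Solver
    d : ℕ → ℚ
    d k = Δ^ k (Δ g) 0
    Sₓ Sₓ₊ : ℚ
    Sₓ = sumℚ D (λ k → ℕtoℚ (x C k) * d k)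
    Sₓ₊ = sumℚ D (λ k → ℕtoℚ (x C suc k) * d k)
    pascal : ∀ k → ℕtoℚ (x C suc k) * d k + ℕtoℚ (x C k) * d k ≡ ℕtoℚ (suc x C suc k) * d k
    pascal k = trans (sym (ℚP.*-distribʳ-+ (d k) (ℕtoℚ (x C suc k)) (ℕtoℚ (x C k))))
                     (cong (_* d k) (trans (ℚP.+-comm (ℕtoℚ (x C suc k)) (ℕtoℚ (x C k))) (sym (ℕtoℚ-pascal x k))))

  sgn : ℕ → ℚ
  sgn j = ℤtoℚ ((ℤ.- (+ 1)) ℤ.^ j)

  sgn-suc : ∀ j → sgn (suc j) ≡ - sgn j
  sgn-suc j = trans (cong ℤtoℚ (ℤP.-1*i≡-i ((ℤ.- (+ 1)) ℤ.^ j))) (ℤtoℚ-neg ((ℤ.- (+ 1)) ℤ.^ j))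

  Δ^-alternating : ∀ k (g : ℕ → ℚ) y →
                   Δ^ k g y ≡ sumℚ (suc k) (λ j → sgn j * ℕtoℚ (k C j) * g (y ℕ.+ (k ∸ j)))
  Δ^-alternating zero    g y = begin
    g y                         ≡⟨ cong g (ℕP.+-identityʳ y) ⟨
    g (y ℕ.+ 0)                 ≡⟨ solve 1 (λ a → a := con 0ℚ :+ con 1ℚ :* con 1ℚ :* a) refl (g (y ℕ.+ 0)) ⟩
    0ℚ + 1ℚ * 1ℚ * g (y ℕ.+ 0)  ∎
    where open ℚ-Solver
  Δ^-alternating (suc k) g y = sym (begin
    sumℚ (suc (suc k)) (λ j → sgn j * ℕtoℚ (suc k C j) * g (y ℕ.+ (suc k ∸ j)))
      ≡⟨ sumℚ-suc (suc k) _ ⟩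
    a 0 * g (y ℕ.+ suc k) + sumℚ (suc k) (λ j → sgn (suc j) * ℕtoℚ (suc k C suc j) * G j)
      ≡⟨ cong (λ t → a 0 * g (y ℕ.+ suc k) + t) (sumℚ-cong (suc k) (λ j _ → pascal j)) ⟩
    a 0 * g (y ℕ.+ suc k) + sumℚ (suc k) (λ j → a (suc j) * G j - a j * G j)
      ≡⟨ cong (λ t → a 0 * g (y ℕ.+ suc k) + t) (sumℚ-- (suc k) _ _) ⟩
    a 0 * g (y ℕ.+ suc k) + (sumℚ (suc k) (λ j → a (suc j) * G j) - sumℚ (suc k) (λ j → a j * G j))
      ≡⟨ ℚP.+-assoc (a 0 * g (y ℕ.+ suc k)) (sumℚ (suc k) (λ j → a (suc j) * G j)) (- sumℚ (suc k) (λ j → a j * G j)) ⟨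
    (a 0 * g (y ℕ.+ suc k) + sumℚ (suc k) (λ j → a (suc j) * G j)) - sumℚ (suc k) (λ j → a j * G j)
      ≡⟨ cong₂ _-_ shifted (Δ^-alternating k g y) ⟨
    Δ^ k g (suc y) - Δ^ k g y
      ≡⟨ Δ^-suc k g y ⟨
    Δ^ (suc k) g y ∎)
    where
    open ℚ-Solver
    a : ℕ → ℚ
    a j = sgn j * ℕtoℚ (k C j)
    G : ℕ → ℚ
    G j = g (y ℕ.+ (k ∸ j))
    pascal : ∀ j → sgn (suc j) * ℕtoℚ (suc k C suc j) * G j ≡ a (suc j) * G j - a j * G j
    pascal j = begin
      sgn (suc j) * ℕtoℚ (suc k C suc j) * G j
        ≡⟨ cong₂ (λ s c → s * c * G j) (sgn-suc j) (ℕtoℚ-pascal k j) ⟩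
      - sgn j * (ℕtoℚ (k C j) + ℕtoℚ (k C suc j)) * G j
        ≡⟨ solve 4 (λ s b c h → :- s :* (b :+ c) :* h := :- s :* c :* h :- s :* b :* h) refl (sgn j) (ℕtoℚ (k C j)) (ℕtoℚ (k C suc j)) (G j) ⟩
      - sgn j * ℕtoℚ (k C suc j) * G j - a j * G j
        ≡⟨ cong (λ s → s * ℕtoℚ (k C suc j) * G j - a j * G j) (sgn-suc j) ⟨
      a (suc j) * G j - a j * G j ∎
    shift-index : ∀ j → j < suc k → y ℕ.+ (suc k ∸ j) ≡ suc y ℕ.+ (k ∸ j)
    shift-index j j<sk = trans (cong (y ℕ.+_) (ℕP.+-∸-assoc 1 (ℕP.≤-pred j<sk))) (ℕP.+-suc y (k ∸ j))
    shifted : Δ^ k g (suc y) ≡ a 0 * g (y ℕ.+ suc k) + sumℚ (suc k) (λ j → a (suc j) * G j)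
    shifted = begin
      Δ^ k g (suc y)                                                ≡⟨ Δ^-alternating k g (suc y) ⟩
      sumℚ (suc k) (λ j → a j * g (suc y ℕ.+ (k ∸ j)))              ≡⟨ sumℚ-cong (suc k) (λ j j<sk → cong (λ i → a j * g i) (shift-index j j<sk)) ⟨
      sumℚ (suc k) (λ j → a j * g (y ℕ.+ (suc k ∸ j)))              ≡⟨ sumℚ-dropLast (suc k) _ (last≡0 _) ⟨
      sumℚ (suc (suc k)) (λ j → a j * g (y ℕ.+ (suc k ∸ j)))        ≡⟨ sumℚ-suc (suc k) _ ⟩
      a 0 * g (y ℕ.+ suc k) + sumℚ (suc k) (λ j → a (suc j) * G j)  ∎
      where
      last≡0 : ∀ z → a (suc k) * z ≡ 0ℚ
      last≡0 z = begin
        sgn (suc k) * ℕtoℚ (k C suc k) * z  ≡⟨ cong (λ c → sgn (suc k) * ℕtoℚ c * z) (k>n⇒nCk≡0 (ℕP.n<1+n k)) ⟩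
        sgn (suc k) * 0ℚ * z                ≡⟨ solve 2 (λ s z → s :* con 0ℚ :* z := con 0ℚ) refl (sgn (suc k)) z ⟩
        0ℚ                                  ∎

  evalPoly : Poly → ℚ → ℚ
  evalPoly []       x = 0ℚ
  evalPoly (a ∷ as) x = ℤtoℚ a + x * evalPoly as x

  -- The inner loop of mulXminus cannot be named, so its effect is described one coefficient at a time.
  evalPoly-mulXminus-∷ : ∀ c a p x → evalPoly (mulXminus c (a ∷ p)) x ≡
                         ℤtoℚ (+ 0 ℤ.- c ℤ.* a) + x * (ℤtoℚ a + evalPoly (mulXminus c p) x)
  evalPoly-mulXminus-∷ c a []       x = cong (λ t → ℤtoℚ (+ 0 ℤ.- c ℤ.* a) + x * t)
    (solve 2 (λ a x → a :+ x :* con 0ℚ := a :+ (con 0ℚ :+ x :* con 0ℚ)) refl (ℤtoℚ a) x)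
    where open ℚ-Solver
  evalPoly-mulXminus-∷ c a (b ∷ bs) x = cong (λ t → ℤtoℚ (+ 0 ℤ.- c ℤ.* a) + x * t) (regroup _)
    where
    regroup : ∀ u → ℤtoℚ (a ℤ.- c ℤ.* b) + u ≡ ℤtoℚ a + (ℤtoℚ (+ 0 ℤ.- c ℤ.* b) + u)
    regroup u = begin
      ℤtoℚ (a ℤ.- c ℤ.* b) + u                     ≡⟨ cong (λ z → ℤtoℚ z + u) (ℤ-Solver.solve 3 (λ a c b → a :- c :* b := a :+ (con (+ 0) :- c :* b)) refl a c b) ⟩
      ℤtoℚ (a ℤ.+ (+ 0 ℤ.- c ℤ.* b)) + u           ≡⟨ cong (_+ u) (ℤtoℚ-+ a (+ 0 ℤ.- c ℤ.* b)) ⟩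
      ℤtoℚ a + ℤtoℚ (+ 0 ℤ.- c ℤ.* b) + u          ≡⟨ ℚP.+-assoc (ℤtoℚ a) (ℤtoℚ (+ 0 ℤ.- c ℤ.* b)) u ⟩
      ℤtoℚ a + (ℤtoℚ (+ 0 ℤ.- c ℤ.* b) + u)        ∎
      where open ℤ-Solver using (_:-_; _:*_; _:+_; _:=_; con)

  evalPoly-mulXminus : ∀ c p x → evalPoly (mulXminus c p) x ≡ (x - ℤtoℚ c) * evalPoly p x
  evalPoly-mulXminus c []      x = solve 2 (λ x c → con 0ℚ :+ x :* con 0ℚ := (x :- c) :* con 0ℚ) refl x (ℤtoℚ c)
    where open ℚ-Solver
  evalPoly-mulXminus c (a ∷ p) x = begin
    evalPoly (mulXminus c (a ∷ p)) x                                 ≡⟨ evalPoly-mulXminus-∷ c a p x ⟩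
    ℤtoℚ (+ 0 ℤ.- c ℤ.* a) + x * (ℤtoℚ a + evalPoly (mulXminus c p) x)
                                                                     ≡⟨ cong₂ (λ s t → s + x * (ℤtoℚ a + t)) -ca (evalPoly-mulXminus c p x) ⟩
    - (ℤtoℚ c * ℤtoℚ a) + x * (ℤtoℚ a + (x - ℤtoℚ c) * evalPoly p x)
                                                                     ≡⟨ solve 4 (λ c a x e → :- (c :* a) :+ x :* (a :+ (x :- c) :* e) := (x :- c) :* (a :+ x :* e)) refl (ℤtoℚ c) (ℤtoℚ a) x (evalPoly p x) ⟩
    (x - ℤtoℚ c) * (ℤtoℚ a + x * evalPoly p x)                       ∎
    where
    open ℚ-Solver
    -ca : ℤtoℚ (+ 0 ℤ.- c ℤ.* a) ≡ - (ℤtoℚ c * ℤtoℚ a)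
    -ca = trans (cong ℤtoℚ (ℤP.+-identityˡ (ℤ.- (c ℤ.* a))))
                (trans (ℤtoℚ-neg (c ℤ.* a)) (cong -_ (ℤtoℚ-* c a)))

  length-mulXminus : ∀ c p → length (mulXminus c p) ≡ suc (length p)
  length-mulXminus c []           = refl
  length-mulXminus c (a ∷ [])     = refl
  length-mulXminus c (a ∷ b ∷ bs) = cong suc (length-mulXminus c (b ∷ bs))

  evalPoly≡sum : ∀ p x → evalPoly p (ℕtoℚ x) ≡ sumℚ (length p) (λ l → ℤtoℚ (nth (+ 0) p l) * ℕtoℚ (x ℕ.^ l))
  evalPoly≡sum []       x = refl
  evalPoly≡sum (a ∷ as) x = begin
    ℤtoℚ a + ℕtoℚ x * evalPoly as (ℕtoℚ x)
      ≡⟨ cong (λ t → ℤtoℚ a + ℕtoℚ x * t) (evalPoly≡sum as x) ⟩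
    ℤtoℚ a + ℕtoℚ x * sumℚ (length as) (λ l → coeff l * ℕtoℚ (x ℕ.^ l))
      ≡⟨ cong₂ _+_ (ℚP.*-identityʳ (ℤtoℚ a)) (sumℚ-*ˡ (length as) (ℕtoℚ x) _) ⟨
    ℤtoℚ a * 1ℚ + sumℚ (length as) (λ l → ℕtoℚ x * (coeff l * ℕtoℚ (x ℕ.^ l)))
      ≡⟨ cong (λ t → ℤtoℚ a * 1ℚ + t) (sumℚ-cong (length as) (λ l _ → raise l)) ⟩
    ℤtoℚ a * 1ℚ + sumℚ (length as) (λ l → coeff l * ℕtoℚ (x ℕ.^ suc l))
      ≡⟨ sumℚ-suc (length as) _ ⟨
    sumℚ (suc (length as)) (λ l → ℤtoℚ (nth (+ 0) (a ∷ as) l) * ℕtoℚ (x ℕ.^ l)) ∎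
    where
    coeff : ℕ → ℚ
    coeff l = ℤtoℚ (nth (+ 0) as l)
    raise : ∀ l → ℕtoℚ x * (coeff l * ℕtoℚ (x ℕ.^ l)) ≡ coeff l * ℕtoℚ (x ℕ.^ suc l)
    raise l = begin
      ℕtoℚ x * (coeff l * ℕtoℚ (x ℕ.^ l))   ≡⟨ solve 3 (λ x c p → x :* (c :* p) := c :* (x :* p)) refl (ℕtoℚ x) (coeff l) (ℕtoℚ (x ℕ.^ l)) ⟩
      coeff l * (ℕtoℚ x * ℕtoℚ (x ℕ.^ l))   ≡⟨ cong (coeff l *_) (ℕtoℚ-* x (x ℕ.^ l)) ⟨
      coeff l * ℕtoℚ (x ℕ.^ suc l)          ∎
      where open ℚ-Solver

  falling : ℚ → ℕ → ℚ
  falling x zero    = 1ℚ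
  falling x (suc k) = (x - ℕtoℚ k) * falling x k

  length-fallingPoly : ∀ k → length (fallingPoly k) ≡ suc k
  length-fallingPoly zero    = refl
  length-fallingPoly (suc k) = trans (length-mulXminus (+ k) (fallingPoly k)) (cong suc (length-fallingPoly k))

  evalPoly-fallingPoly : ∀ k x → evalPoly (fallingPoly k) x ≡ falling x k
  evalPoly-fallingPoly zero    x = trans (cong (λ t → 1ℚ + t) (ℚP.*-zeroʳ x)) (ℚP.+-identityʳ 1ℚ)
  evalPoly-fallingPoly (suc k) x = trans (evalPoly-mulXminus (+ k) (fallingPoly k) x)
                                         (cong ((x - ℕtoℚ k) *_) (evalPoly-fallingPoly k x))

  falling-suc : ∀ x k → falling (x + 1ℚ) (suc k) ≡ (x + 1ℚ) * falling x k
  falling-suc x zero    = solve 1 (λ x → (x :+ con 1ℚ :- con 0ℚ) :* con 1ℚ := (x :+ con 1ℚ) :* con 1ℚ) refl x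
    where open ℚ-Solver
  falling-suc x (suc k) = begin
    (x + 1ℚ - ℕtoℚ (suc k)) * falling (x + 1ℚ) (suc k)  ≡⟨ cong₂ (λ u v → (x + 1ℚ - u) * v) (ℕtoℚ-suc k) (falling-suc x k) ⟩
    (x + 1ℚ - (ℕtoℚ k + 1ℚ)) * ((x + 1ℚ) * falling x k) ≡⟨ solve 3 (λ x k f → (x :+ con 1ℚ :- (k :+ con 1ℚ)) :* ((x :+ con 1ℚ) :* f) := (x :+ con 1ℚ) :* ((x :- k) :* f)) refl x (ℕtoℚ k) (falling x k) ⟩
    (x + 1ℚ) * ((x - ℕtoℚ k) * falling x k)             ∎
    where open ℚ-Solver

  falling-zero : ∀ k → falling 0ℚ (suc k) ≡ 0ℚ
  falling-zero zero    = refl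
  falling-zero (suc k) = trans (cong ((0ℚ - ℕtoℚ (suc k)) *_) (falling-zero k)) (ℚP.*-zeroʳ (0ℚ - ℕtoℚ (suc k)))

  C*!≡falling : ∀ x k → ℕtoℚ (x C k) * ℕtoℚ (k !) ≡ falling (ℕtoℚ x) k
  C*!≡falling x       zero    = refl
  C*!≡falling zero    (suc k) = trans (ℚP.*-zeroˡ (ℕtoℚ (suc k !))) (sym (falling-zero k))
  C*!≡falling (suc x) (suc k) = begin
    ℕtoℚ (suc x C suc k) * ℕtoℚ (suc k !)
      ≡⟨ cong₂ _*_ (ℕtoℚ-pascal x k) [k+1]! ⟩
    (ℕtoℚ (x C k) + ℕtoℚ (x C suc k)) * ((ℕtoℚ k + 1ℚ) * ℕtoℚ (k !))
      ≡⟨ solve 4 (λ a b k f → (a :+ b) :* ((k :+ con 1ℚ) :* f) := (k :+ con 1ℚ) :* (a :* f) :+ b :* ((k :+ con 1ℚ) :* f)) refl (ℕtoℚ (x C k)) (ℕtoℚ (x C suc k)) (ℕtoℚ k) (ℕtoℚ (k !)) ⟩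
    (ℕtoℚ k + 1ℚ) * (ℕtoℚ (x C k) * ℕtoℚ (k !)) + ℕtoℚ (x C suc k) * ((ℕtoℚ k + 1ℚ) * ℕtoℚ (k !))
      ≡⟨ cong (λ t → (ℕtoℚ k + 1ℚ) * (ℕtoℚ (x C k) * ℕtoℚ (k !)) + ℕtoℚ (x C suc k) * t) [k+1]! ⟨
    (ℕtoℚ k + 1ℚ) * (ℕtoℚ (x C k) * ℕtoℚ (k !)) + ℕtoℚ (x C suc k) * ℕtoℚ (suc k !)
      ≡⟨ cong₂ (λ u v → (ℕtoℚ k + 1ℚ) * u + v) (C*!≡falling x k) (C*!≡falling x (suc k)) ⟩
    (ℕtoℚ k + 1ℚ) * falling (ℕtoℚ x) k + (ℕtoℚ x - ℕtoℚ k) * falling (ℕtoℚ x) k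
      ≡⟨ solve 3 (λ k x f → (k :+ con 1ℚ) :* f :+ (x :- k) :* f := (x :+ con 1ℚ) :* f) refl (ℕtoℚ k) (ℕtoℚ x) (falling (ℕtoℚ x) k) ⟩
    (ℕtoℚ x + 1ℚ) * falling (ℕtoℚ x) k
      ≡⟨ falling-suc (ℕtoℚ x) k ⟨
    falling (ℕtoℚ x + 1ℚ) (suc k)
      ≡⟨ cong (λ z → falling z (suc k)) (ℕtoℚ-suc x) ⟨
    falling (ℕtoℚ (suc x)) (suc k) ∎
    where
    open ℚ-Solver
    [k+1]! : ℕtoℚ (suc k !) ≡ (ℕtoℚ k + 1ℚ) * ℕtoℚ (k !)
    [k+1]! = trans (ℕtoℚ-* (suc k) (k !)) (cong (_* ℕtoℚ (k !)) (ℕtoℚ-suc k))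

  C≡stirling : ∀ x k → ℕtoℚ (x C k) ≡ sumℚ (suc k) (λ l → ℤtoℚ (S₁ k l) * ℕtoℚ (x ℕ.^ l) * invFact k)
  C≡stirling x k = begin
    ℕtoℚ (x C k)                                         ≡⟨ ℚP.*-identityʳ (ℕtoℚ (x C k)) ⟨
    ℕtoℚ (x C k) * 1ℚ                                    ≡⟨ cong (ℕtoℚ (x C k) *_) !*invFact ⟨
    ℕtoℚ (x C k) * (ℕtoℚ (k !) * invFact k)              ≡⟨ ℚP.*-assoc (ℕtoℚ (x C k)) (ℕtoℚ (k !)) (invFact k) ⟨
    ℕtoℚ (x C k) * ℕtoℚ (k !) * invFact k                ≡⟨ cong (_* invFact k) (C*!≡falling x k) ⟩
    falling (ℕtoℚ x) k * invFact k                       ≡⟨ cong (_* invFact k) (evalPoly-fallingPoly k (ℕtoℚ x)) ⟨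
    evalPoly (fallingPoly k) (ℕtoℚ x) * invFact k        ≡⟨ cong (_* invFact k) (evalPoly≡sum (fallingPoly k) x) ⟩
    sumℚ (length (fallingPoly k)) (λ l → ℤtoℚ (S₁ k l) * ℕtoℚ (x ℕ.^ l)) * invFact k
                                                         ≡⟨ cong (λ n → sumℚ n (λ l → ℤtoℚ (S₁ k l) * ℕtoℚ (x ℕ.^ l)) * invFact k) (length-fallingPoly k) ⟩
    sumℚ (suc k) (λ l → ℤtoℚ (S₁ k l) * ℕtoℚ (x ℕ.^ l)) * invFact k
                                                         ≡⟨ sumℚ-*ʳ (suc k) (invFact k) _ ⟨
    sumℚ (suc k) (λ l → ℤtoℚ (S₁ k l) * ℕtoℚ (x ℕ.^ l) * invFact k) ∎
    where
    !*invFact : ℕtoℚ (k !) * invFact k ≡ 1ℚ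
    !*invFact = trans (ℚP.*-comm (ℕtoℚ (k !)) (invFact k)) (1/n*n≡1 (k !) {{k ℕP.!≢0}})

  binomial : ∀ x e → ℕtoℚ (suc x ℕ.^ e) ≡ sumℚ (suc e) (λ j → ℕtoℚ (e C j) * ℕtoℚ (x ℕ.^ j))
  binomial x zero    = refl
  binomial x (suc e) = begin
    ℕtoℚ (suc x ℕ.* suc x ℕ.^ e)                       ≡⟨ trans (ℕtoℚ-* (suc x) (suc x ℕ.^ e)) (cong₂ _*_ (ℕtoℚ-suc x) (binomial x e)) ⟩
    (X + 1ℚ) * sumℚ (suc e) F                          ≡⟨ ℚP.*-distribʳ-+ (sumℚ (suc e) F) X 1ℚ ⟩
    X * sumℚ (suc e) F + 1ℚ * sumℚ (suc e) F           ≡⟨ cong₂ _+_ (sumℚ-*ˡ (suc e) X F) (sym (ℚP.*-identityˡ (sumℚ (suc e) F))) ⟨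
    sumℚ (suc e) (λ j → X * F j) + sumℚ (suc e) F      ≡⟨ cong (λ t → sumℚ (suc e) (λ j → X * F j) + t) (trans (sumℚ-suc e F) (cong (λ t → 1ℚ * 1ℚ + t) F↑)) ⟩
    sumℚ (suc e) (λ j → X * F j) + (1ℚ * 1ℚ + U)       ≡⟨ solve 3 (λ a b c → a :+ (b :+ c) := b :+ (a :+ c)) refl (sumℚ (suc e) (λ j → X * F j)) (1ℚ * 1ℚ) U ⟩
    1ℚ * 1ℚ + (sumℚ (suc e) (λ j → X * F j) + U)       ≡⟨ cong (λ t → 1ℚ * 1ℚ + t) (sumℚ-+ (suc e) _ _) ⟨
    1ℚ * 1ℚ + sumℚ (suc e) (λ j → X * F j + ℕtoℚ (e C suc j) * ℕtoℚ (x ℕ.^ suc j))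
                                                       ≡⟨ cong (λ t → 1ℚ * 1ℚ + t) (sumℚ-cong (suc e) (λ j _ → pascal j)) ⟩
    1ℚ * 1ℚ + sumℚ (suc e) (λ j → ℕtoℚ (suc e C suc j) * ℕtoℚ (x ℕ.^ suc j))
                                                       ≡⟨ sumℚ-suc (suc e) _ ⟨
    sumℚ (suc (suc e)) (λ j → ℕtoℚ (suc e C j) * ℕtoℚ (x ℕ.^ j)) ∎
    where
    open ℚ-Solver
    X : ℚ
    X = ℕtoℚ x
    F : ℕ → ℚ
    F j = ℕtoℚ (e C j) * ℕtoℚ (x ℕ.^ j)
    U : ℚ
    U = sumℚ (suc e) (λ j → ℕtoℚ (e C suc j) * ℕtoℚ (x ℕ.^ suc j))
    F↑ : sumℚ e (λ j → F (suc j)) ≡ U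
    F↑ = sym (sumℚ-dropLast e _ (trans (cong (λ c → ℕtoℚ c * ℕtoℚ (x ℕ.^ suc e)) (k>n⇒nCk≡0 (ℕP.n<1+n e)))
                                        (ℚP.*-zeroˡ (ℕtoℚ (x ℕ.^ suc e)))))
    pascal : ∀ j → X * F j + ℕtoℚ (e C suc j) * ℕtoℚ (x ℕ.^ suc j) ≡ ℕtoℚ (suc e C suc j) * ℕtoℚ (x ℕ.^ suc j)
    pascal j = begin
      X * F j + ℕtoℚ (e C suc j) * ℕtoℚ (x ℕ.^ suc j)
        ≡⟨ cong (λ t → X * F j + ℕtoℚ (e C suc j) * t) (ℕtoℚ-* x (x ℕ.^ j)) ⟩
      X * (ℕtoℚ (e C j) * ℕtoℚ (x ℕ.^ j)) + ℕtoℚ (e C suc j) * (X * ℕtoℚ (x ℕ.^ j))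
        ≡⟨ solve 4 (λ x a b p → x :* (a :* p) :+ b :* (x :* p) := (a :+ b) :* (x :* p)) refl X (ℕtoℚ (e C j)) (ℕtoℚ (e C suc j)) (ℕtoℚ (x ℕ.^ j)) ⟩
      (ℕtoℚ (e C j) + ℕtoℚ (e C suc j)) * (X * ℕtoℚ (x ℕ.^ j))
        ≡⟨ cong₂ _*_ (ℕtoℚ-pascal e j) (ℕtoℚ-* x (x ℕ.^ j)) ⟨
      ℕtoℚ (suc e C suc j) * ℕtoℚ (x ℕ.^ suc j) ∎

  binomial-Δ : ∀ m x → sumℚ (suc m) (λ j → ℕtoℚ (suc m C j) * ℕtoℚ (x ℕ.^ j)) ≡
                       ℕtoℚ (suc x ℕ.^ suc m) - ℕtoℚ (x ℕ.^ suc m)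
  binomial-Δ m x = begin
    S                                                             ≡⟨ solve 2 (λ s t → s := (s :+ con 1ℚ :* t) :- t) refl S (ℕtoℚ (x ℕ.^ suc m)) ⟩
    (S + 1ℚ * ℕtoℚ (x ℕ.^ suc m)) - ℕtoℚ (x ℕ.^ suc m)            ≡⟨ cong (λ c → (S + ℕtoℚ c * ℕtoℚ (x ℕ.^ suc m)) - ℕtoℚ (x ℕ.^ suc m)) (nCn≡1 (suc m)) ⟨
    (S + ℕtoℚ (suc m C suc m) * ℕtoℚ (x ℕ.^ suc m)) - ℕtoℚ (x ℕ.^ suc m)
                                                                  ≡⟨ cong (_- ℕtoℚ (x ℕ.^ suc m)) (binomial x (suc m)) ⟨
    ℕtoℚ (suc x ℕ.^ suc m) - ℕtoℚ (x ℕ.^ suc m)         ∎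
    where
    open ℚ-Solver
    S : ℚ
    S = sumℚ (suc m) (λ j → ℕtoℚ (suc m C j) * ℕtoℚ (x ℕ.^ j))

  nth-++ˡ : ∀ {A : Set} (d : A) xs ys j → j < length xs → nth d (xs ++ ys) j ≡ nth d xs j
  nth-++ˡ d (x ∷ xs) ys zero    _          = refl
  nth-++ˡ d (x ∷ xs) ys (suc j) (ℕ.s≤s j<) = nth-++ˡ d xs ys j j<

  nth-length : ∀ {A : Set} (d : A) xs y → nth d (xs ++ y ∷ []) (length xs) ≡ y
  nth-length d []       y = refl
  nth-length d (x ∷ xs) y = nth-length d xs y

  length-bernoulliList : ∀ m → length (bernoulliList m) ≡ m
  length-bernoulliList zero    = refl
  length-bernoulliList (suc m) = trans (length-++ (bernoulliList m))
                                       (trans (ℕP.+-comm (length (bernoulliList m)) 1) (cong suc (length-bernoulliList m)))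

  nth-bernoulliList : ∀ m j → j < m → nth 0ℚ (bernoulliList m) j ≡ B j
  nth-bernoulliList (suc m) j j<1+m with ℕP.m≤n⇒m<n∨m≡n (ℕP.≤-pred j<1+m)
  ... | inj₁ j<m  = trans (nth-++ˡ 0ℚ (bernoulliList m) _ j (subst (j <_) (sym (length-bernoulliList m)) j<m))
                          (nth-bernoulliList m j j<m)
  ... | inj₂ refl = refl

  [m+1]Cm≡m+1 : ∀ m → suc m C m ≡ suc m
  [m+1]Cm≡m+1 m = trans (nCk≡nC[n∸k] (ℕP.n≤1+n m)) (trans (cong (suc m C_) (ℕP.m+n∸n≡m 1 m)) (nC1≡n (suc m)))

  bernoulli-recurrence : ∀ m → sumℚ (suc m) (λ j → ℕtoℚ (suc m C j) * B j) ≡ isZero m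
  bernoulli-recurrence m = begin
    S + ℕtoℚ (suc m C m) * B m                              ≡⟨ cong₂ (λ c b → S + ℕtoℚ c * b) ([m+1]Cm≡m+1 m) B-unfold ⟩
    S + ℕtoℚ (suc m) * ((+ 1 / suc m) * (isZero m - S))     ≡⟨ solve 4 (λ s n i z → s :+ n :* (i :* (z :- s)) := s :+ (i :* n) :* (z :- s)) refl S (ℕtoℚ (suc m)) (+ 1 / suc m) (isZero m) ⟩
    S + ((+ 1 / suc m) * ℕtoℚ (suc m)) * (isZero m - S)     ≡⟨ cong (λ t → S + t * (isZero m - S)) (1/n*n≡1 (suc m)) ⟩
    S + 1ℚ * (isZero m - S)                                 ≡⟨ solve 2 (λ s z → s :+ con 1ℚ :* (z :- s) := z) refl S (isZero m) ⟩
    isZero m                                                ∎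
    where
    open ℚ-Solver
    S : ℚ
    S = sumℚ m (λ j → ℕtoℚ (suc m C j) * B j)
    B-unfold : B m ≡ (+ 1 / suc m) * (isZero m - S)
    B-unfold = begin
      B m                                        ≡⟨ cong (nth 0ℚ (bernoulliList (suc m))) (length-bernoulliList m) ⟨
      nth 0ℚ (bernoulliList (suc m)) (length (bernoulliList m))
                                                 ≡⟨ nth-length 0ℚ (bernoulliList m) _ ⟩
      (+ 1 / suc m) * (isZero m - sumℚ m (λ j → ℕtoℚ (suc m C j) * nth 0ℚ (bernoulliList m) j))
                                                 ≡⟨ cong (λ t → (+ 1 / suc m) * (isZero m - t))
                                                         (sumℚ-cong m (λ j j<m → cong (ℕtoℚ (suc m C j) *_) (nth-bernoulliList m j j<m))) ⟩
      (+ 1 / suc m) * (isZero m - S)             ∎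

  module Volkenborn (p : ℕ) (pp : Prime p) where

    private instance
      p≢0 : NonZero p
      p≢0 = prime⇒nonZero pp

    p^ᶻ : ℕ → ℤ
    p^ᶻ k = + (p ℕ.^ k)

    p^ᶻ-+ : ∀ e k → p^ᶻ (e ℕ.+ k) ≡ p^ᶻ e ℤ.* p^ᶻ k
    p^ᶻ-+ e k = trans (cong +_ (ℕP.^-distribˡ-+-* p e k)) (ℤP.pos-* (p ℕ.^ e) (p ℕ.^ k))

    p∤1 : ¬ (p ∣ 1)
    p∤1 p∣1 = ℕ.nonTrivial⇒≢1 {{prime⇒nonTrivial pp}} (∣1⇒≡1 p∣1)

    p∤* : ∀ a b → ¬ (+ p) ℤDiv.∣ a → ¬ (+ p) ℤDiv.∣ b → ¬ (+ p) ℤDiv.∣ (a ℤ.* b)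
    p∤* a b p∤a p∤b p∣ab with euclidsLemma (ℤ.∣ a ∣) (ℤ.∣ b ∣) pp (subst (p ∣_) (ℤP.abs-* a b) p∣ab)
    ... | inj₁ p∣a = p∤a p∣a
    ... | inj₂ p∣b = p∤b p∣b

    p-adicSplit : ∀ w .{{_ : NonZero w}} → Acc _<_ w → ∃ λ e → ∃ λ u → w ≡ p ℕ.^ e ℕ.* u × ¬ (p ∣ u)
    p-adicSplit w (acc rec) with p ∣? w
    ... | no  p∤w = 0 , w , sym (ℕP.+-identityʳ w) , p∤w
    ... | yes p∣w with p-adicSplit (quotient p∣w) {{quotient≢0 p∣w}} (rec (quotient-< p∣w {{prime⇒nonTrivial pp}}))
    ...   | e , u , q≡p^e*u , p∤u = suc e , u , w≡p^[1+e]*u , p∤u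
      where
      w≡p^[1+e]*u : w ≡ p ℕ.^ suc e ℕ.* u
      w≡p^[1+e]*u = trans (_∣_.equality p∣w) (trans (cong (ℕ._* p) q≡p^e*u)
                      (ℕ-Solver.solve 3 (λ a b c → (a :* b) :* c := c :* a :* b) refl (p ℕ.^ e) u p))
        where open ℕ-Solver using (_:*_; _:=_)

    InPowZp-0 : ∀ k → InPowZp p k 0ℚ
    InPowZp-0 k = + 0 , + 1 , p∤1 , cong ℤtoℚ (sym (ℤP.*-zeroʳ (p^ᶻ k)))

    InPowZp-+ : ∀ k q r → InPowZp p k q → InPowZp p k r → InPowZp p k (q + r)
    InPowZp-+ k q r (a , b , p∤b , qb≡) (a′ , b′ , p∤b′ , rb′≡) =
      a ℤ.* b′ ℤ.+ a′ ℤ.* b , b ℤ.* b′ , p∤* b b′ p∤b p∤b′ , (begin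
        (q + r) * ℤtoℚ (b ℤ.* b′)
          ≡⟨ cong ((q + r) *_) (ℤtoℚ-* b b′) ⟩
        (q + r) * (ℤtoℚ b * ℤtoℚ b′)
          ≡⟨ (let open ℚ-Solver in solve 4 (λ q r b b′ → (q :+ r) :* (b :* b′) := (q :* b) :* b′ :+ (r :* b′) :* b) refl q r (ℤtoℚ b) (ℤtoℚ b′)) ⟩
        (q * ℤtoℚ b) * ℤtoℚ b′ + (r * ℤtoℚ b′) * ℤtoℚ b
          ≡⟨ cong₂ (λ u v → u * ℤtoℚ b′ + v * ℤtoℚ b) qb≡ rb′≡ ⟩
        ℤtoℚ (p^ᶻ k ℤ.* a) * ℤtoℚ b′ + ℤtoℚ (p^ᶻ k ℤ.* a′) * ℤtoℚ b
          ≡⟨ cong₂ _+_ (ℤtoℚ-* (p^ᶻ k ℤ.* a) b′) (ℤtoℚ-* (p^ᶻ k ℤ.* a′) b) ⟨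
        ℤtoℚ (p^ᶻ k ℤ.* a ℤ.* b′) + ℤtoℚ (p^ᶻ k ℤ.* a′ ℤ.* b)
          ≡⟨ ℤtoℚ-+ (p^ᶻ k ℤ.* a ℤ.* b′) (p^ᶻ k ℤ.* a′ ℤ.* b) ⟨
        ℤtoℚ (p^ᶻ k ℤ.* a ℤ.* b′ ℤ.+ p^ᶻ k ℤ.* a′ ℤ.* b)
          ≡⟨ cong ℤtoℚ (let open ℤ-Solver in solve 5 (λ P a b′ a′ b → P :* a :* b′ :+ P :* a′ :* b := P :* (a :* b′ :+ a′ :* b)) refl (p^ᶻ k) a b′ a′ b) ⟩
        ℤtoℚ (p^ᶻ k ℤ.* (a ℤ.* b′ ℤ.+ a′ ℤ.* b)) ∎)

    InPowZp-neg : ∀ k q → InPowZp p k q → InPowZp p k (- q)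
    InPowZp-neg k q (a , b , p∤b , qb≡) = ℤ.- a , b , p∤b , (begin
      (- q) * ℤtoℚ b           ≡⟨ ℚP.neg-distribˡ-* q (ℤtoℚ b) ⟨
      - (q * ℤtoℚ b)           ≡⟨ cong -_ qb≡ ⟩
      - ℤtoℚ (p^ᶻ k ℤ.* a)     ≡⟨ ℤtoℚ-neg (p^ᶻ k ℤ.* a) ⟨
      ℤtoℚ (ℤ.- (p^ᶻ k ℤ.* a)) ≡⟨ cong ℤtoℚ (ℤP.neg-distribʳ-* (p^ᶻ k) a) ⟩
      ℤtoℚ (p^ᶻ k ℤ.* ℤ.- a)   ∎)

    -- Multiplying by c costs at most the p-adic valuation e of its denominator.
    InPowZp-*ˡ : ∀ c → ∃ λ e → ∀ k q → InPowZp p (e ℕ.+ k) q → InPowZp p k (c * q)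
    InPowZp-*ˡ c@(ℚ.mkℚ n d-1 _) with p-adicSplit (suc d-1) (<-wellFounded (suc d-1))
    ... | e , w , d≡p^e*w , p∤w = e , λ k q (a , b , p∤b , qb≡) →
      n ℤ.* a , b ℤ.* + w , p∤* b (+ w) p∤b p∤w ,
      *-cancelʳ-ℕtoℚ _ _ (p ℕ.^ e) {{ℕP.m^n≢0 p e}} (scaled k q a b qb≡)
      where
      ↧c≡ : ℤtoℚ (↧ c) ≡ ℤtoℚ (p^ᶻ e) * ℤtoℚ (+ w)
      ↧c≡ = trans (cong (λ z → ℤtoℚ (+ z)) d≡p^e*w) (trans (cong ℤtoℚ (ℤP.pos-* (p ℕ.^ e) w)) (ℤtoℚ-* (p^ᶻ e) (+ w)))
      scaled : ∀ k q a b → q * ℤtoℚ b ≡ ℤtoℚ (p^ᶻ (e ℕ.+ k) ℤ.* a) →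
               (c * q) * ℤtoℚ (b ℤ.* + w) * ℕtoℚ (p ℕ.^ e) ≡ ℤtoℚ (p^ᶻ k ℤ.* (n ℤ.* a)) * ℕtoℚ (p ℕ.^ e)
      scaled k q a b qb≡ = begin
        (c * q) * ℤtoℚ (b ℤ.* + w) * ℤtoℚ (p^ᶻ e)
          ≡⟨ cong (λ z → (c * q) * z * ℤtoℚ (p^ᶻ e)) (ℤtoℚ-* b (+ w)) ⟩
        (c * q) * (ℤtoℚ b * ℤtoℚ (+ w)) * ℤtoℚ (p^ᶻ e)
          ≡⟨ (let open ℚ-Solver in solve 5 (λ c q b w P → (c :* q) :* (b :* w) :* P := (c :* (P :* w)) :* (q :* b)) refl c q (ℤtoℚ b) (ℤtoℚ (+ w)) (ℤtoℚ (p^ᶻ e))) ⟩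
        (c * (ℤtoℚ (p^ᶻ e) * ℤtoℚ (+ w))) * (q * ℤtoℚ b)
          ≡⟨ cong₂ (λ u v → (c * u) * v) ↧c≡ (sym qb≡) ⟨
        (c * ℤtoℚ (↧ c)) * ℤtoℚ (p^ᶻ (e ℕ.+ k) ℤ.* a)
          ≡⟨ cong (_* ℤtoℚ (p^ᶻ (e ℕ.+ k) ℤ.* a)) (*-↧≡↥ c) ⟩
        ℤtoℚ n * ℤtoℚ (p^ᶻ (e ℕ.+ k) ℤ.* a)
          ≡⟨ ℤtoℚ-* n _ ⟨
        ℤtoℚ (n ℤ.* (p^ᶻ (e ℕ.+ k) ℤ.* a))
          ≡⟨ cong (λ z → ℤtoℚ (n ℤ.* (z ℤ.* a))) (p^ᶻ-+ e k) ⟩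
        ℤtoℚ (n ℤ.* (p^ᶻ e ℤ.* p^ᶻ k ℤ.* a))
          ≡⟨ cong ℤtoℚ (let open ℤ-Solver in solve 4 (λ n P Q a → n :* (P :* Q :* a) := Q :* (n :* a) :* P) refl n (p^ᶻ e) (p^ᶻ k) a) ⟩
        ℤtoℚ (p^ᶻ k ℤ.* (n ℤ.* a) ℤ.* p^ᶻ e)
          ≡⟨ ℤtoℚ-* (p^ᶻ k ℤ.* (n ℤ.* a)) (p^ᶻ e) ⟩
        ℤtoℚ (p^ᶻ k ℤ.* (n ℤ.* a)) * ℤtoℚ (p^ᶻ e) ∎

    Null : (ℕ → ℚ) → Set
    Null s = ∀ k → ∃ λ N₀ → ∀ N → N₀ ≤ N → InPowZp p k (s N)

    null-cong : ∀ {s t} → (∀ N → s N ≡ t N) → Null s → Null t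
    null-cong s≡t null-s k with null-s k
    ... | N₀ , small = N₀ , λ N N₀≤N → subst (InPowZp p k) (s≡t N) (small N N₀≤N)

    null-zero : Null (λ _ → 0ℚ)
    null-zero k = 0 , λ _ _ → InPowZp-0 k

    null-+ : ∀ {s t} → Null s → Null t → Null (λ N → s N + t N)
    null-+ {s} {t} null-s null-t k with null-s k | null-t k
    ... | N₁ , small₁ | N₂ , small₂ = N₁ ⊔ N₂ , λ N ⊔≤N →
      InPowZp-+ k (s N) (t N) (small₁ N (ℕP.≤-trans (ℕP.m≤m⊔n N₁ N₂) ⊔≤N)) (small₂ N (ℕP.≤-trans (ℕP.m≤n⊔m N₁ N₂) ⊔≤N))

    null-neg : ∀ {s} → Null s → Null (λ N → - s N)
    null-neg {s} null-s k with null-s k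
    ... | N₀ , small = N₀ , λ N N₀≤N → InPowZp-neg k (s N) (small N N₀≤N)

    null-*ˡ : ∀ c {s} → Null s → Null (λ N → c * s N)
    null-*ˡ c {s} null-s k with InPowZp-*ˡ c
    ... | e , scale with null-s (e ℕ.+ k)
    ...   | N₀ , small = N₀ , λ N N₀≤N → scale k (s N) (small N N₀≤N)

    null-sum : ∀ n {s : ℕ → ℕ → ℚ} → (∀ i → i < n → Null (s i)) → Null (λ N → sumℚ n (λ i → s i N))
    null-sum zero    null-s = null-zero
    null-sum (suc n) {s} null-s = null-+ {λ N → sumℚ n (λ i → s i N)} {s n} (null-sum n (λ i i<n → null-s i (ℕP.m<n⇒m<1+n i<n))) (null-s n (ℕP.n<1+n n))

    null-pow : ∀ m → Null (λ N → ℕtoℚ ((p ℕ.^ N) ℕ.^ suc m))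
    null-pow m k = k , λ N k≤N → + (p ℕ.^ (N ∸ k) ℕ.* (p ℕ.^ N) ℕ.^ m) , + 1 , p∤1 ,
      trans (ℚP.*-identityʳ _) (trans (cong ℕtoℚ (split N k≤N)) (cong ℤtoℚ (ℤP.pos-* (p ℕ.^ k) _)))
      where
      split : ∀ N → k ≤ N → (p ℕ.^ N) ℕ.^ suc m ≡ p ℕ.^ k ℕ.* (p ℕ.^ (N ∸ k) ℕ.* (p ℕ.^ N) ℕ.^ m)
      split N k≤N = begin
        p ℕ.^ N ℕ.* (p ℕ.^ N) ℕ.^ m                    ≡⟨ cong (λ i → p ℕ.^ i ℕ.* (p ℕ.^ N) ℕ.^ m) (ℕP.m+[n∸m]≡n k≤N) ⟨
        p ℕ.^ (k ℕ.+ (N ∸ k)) ℕ.* (p ℕ.^ N) ℕ.^ m      ≡⟨ cong (ℕ._* (p ℕ.^ N) ℕ.^ m) (ℕP.^-distribˡ-+-* p k (N ∸ k)) ⟩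
        p ℕ.^ k ℕ.* p ℕ.^ (N ∸ k) ℕ.* (p ℕ.^ N) ℕ.^ m  ≡⟨ ℕP.*-assoc (p ℕ.^ k) _ _ ⟩
        p ℕ.^ k ℕ.* (p ℕ.^ (N ∸ k) ℕ.* (p ℕ.^ N) ℕ.^ m) ∎

    null-triangular : (c : ℕ → ℕ → ℚ) (c⁻¹ : ℕ → ℚ) (e : ℕ → ℕ → ℚ) →
                      (∀ m → c⁻¹ m * c m m ≡ 1ℚ) →
                      (∀ m → Null (λ N → sumℚ (suc m) (λ j → c m j * e j N))) →
                      ∀ m → Null (e m)
    null-triangular c c⁻¹ e inverse null-row = <-rec (λ m → Null (e m)) step
      where
      step : ∀ m → (∀ {j} → j < m → Null (e j)) → Null (e m)
      step m null-below = null-cong solved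
        (null-*ˡ (c⁻¹ m) (null-+ {λ N → sumℚ (suc m) (λ j → c m j * e j N)} (null-row m) (null-neg {λ N → sumℚ m (λ j → c m j * e j N)} (null-sum m {λ j N → c m j * e j N}
                                                             (λ j j<m → null-*ˡ (c m j) (null-below j<m))))))
        where
        solved : ∀ N → c⁻¹ m * (sumℚ (suc m) (λ j → c m j * e j N) + - sumℚ m (λ j → c m j * e j N)) ≡ e m N
        solved N = begin
          c⁻¹ m * ((S + c m m * e m N) + - S)  ≡⟨ solve 4 (λ i s c x → i :* ((s :+ c :* x) :+ :- s) := (i :* c) :* x) refl (c⁻¹ m) S (c m m) (e m N) ⟩
          (c⁻¹ m * c m m) * e m N              ≡⟨ cong (_* e m N) (inverse m) ⟩
          1ℚ * e m N                           ≡⟨ ℚP.*-identityˡ (e m N) ⟩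
          e m N                                ∎
          where
          open ℚ-Solver
          S : ℚ
          S = sumℚ m (λ j → c m j * e j N)

    riemann : ℕ → (ℕ → ℚ) → ℚ
    riemann N h = sumℚ (p ℕ.^ N) h * (+ 1 / p ℕ.^ N) {{ℕP.m^n≢0 p N}}

    riemann-sum : ∀ N n (h : ℕ → ℕ → ℚ) → riemann N (λ x → sumℚ n (λ i → h i x)) ≡ sumℚ n (λ i → riemann N (h i))
    riemann-sum N n h = trans (cong (_* (+ 1 / p ℕ.^ N) {{ℕP.m^n≢0 p N}}) (sumℚ-swap (p ℕ.^ N) n (λ x i → h i x)))
                              (sym (sumℚ-*ʳ n _ (λ i → sumℚ (p ℕ.^ N) (h i))))

    riemann-*ˡ : ∀ N c (h : ℕ → ℚ) → riemann N (λ x → c * h x) ≡ c * riemann N h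
    riemann-*ˡ N c h = trans (cong (_* (+ 1 / p ℕ.^ N) {{ℕP.m^n≢0 p N}}) (sumℚ-*ˡ (p ℕ.^ N) c h)) (ℚP.*-assoc c _ _)

    riemann-telescope : ∀ N (g : ℕ → ℚ) → riemann N (λ x → g (suc x) - g x) ≡ (g (p ℕ.^ N) - g 0) * (+ 1 / p ℕ.^ N) {{ℕP.m^n≢0 p N}}
    riemann-telescope N g = cong (_* (+ 1 / p ℕ.^ N) {{ℕP.m^n≢0 p N}}) (sumℚ-telescope (p ℕ.^ N) g)

    HasIntegral : (ℕ → ℚ) → ℚ → Set
    HasIntegral h L = Null (λ N → riemann N h - L)

    integral-cong : ∀ {h h′ L} → (∀ x → h x ≡ h′ x) → HasIntegral h L → HasIntegral h′ L
    integral-cong {L = L} h≡h′ = null-cong (λ N → cong (λ s → s - L)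
      (cong (_* (+ 1 / p ℕ.^ N) {{ℕP.m^n≢0 p N}}) (sumℚ-cong (p ℕ.^ N) (λ x _ → h≡h′ x))))

    integral-sum : ∀ n {h : ℕ → ℕ → ℚ} {L : ℕ → ℚ} → (∀ i → HasIntegral (h i) (L i)) →
                   HasIntegral (λ x → sumℚ n (λ i → h i x)) (sumℚ n L)
    integral-sum n {h} {L} ∫h = null-cong regroup (null-sum n (λ i _ → ∫h i))
      where
      regroup : ∀ N → sumℚ n (λ i → riemann N (h i) - L i) ≡ riemann N (λ x → sumℚ n (λ i → h i x)) - sumℚ n L
      regroup N = trans (sumℚ-- n (λ i → riemann N (h i)) L) (cong (_- sumℚ n L) (sym (riemann-sum N n h)))

    integral-*ˡ : ∀ c {h L} → HasIntegral h L → HasIntegral (λ x → c * h x) (c * L)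
    integral-*ˡ c {h} {L} ∫h = null-cong regroup (null-*ˡ c ∫h)
      where
      regroup : ∀ N → c * (riemann N h - L) ≡ riemann N (λ x → c * h x) - c * L
      regroup N = trans (solve 3 (λ c r l → c :* (r :- l) := c :* r :- c :* l) refl c (riemann N h) L)
                        (cong (_- c * L) (sym (riemann-*ˡ N c h)))
        where open ℚ-Solver

    integral-*ʳ : ∀ c {h L} → HasIntegral h L → HasIntegral (λ x → h x * c) (L * c)
    integral-*ʳ c {h} {L} ∫h = subst (HasIntegral (λ x → h x * c)) (ℚP.*-comm c L)
      (integral-cong (λ x → ℚP.*-comm c (h x)) (integral-*ˡ c ∫h))

    powerSum-recurrence : ∀ m N → sumℚ (suc m) (λ j → ℕtoℚ (suc m C j) * riemann N (λ x → ℕtoℚ (x ℕ.^ j))) ≡ ℕtoℚ ((p ℕ.^ N) ℕ.^ m)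
    powerSum-recurrence m N = begin
      sumℚ (suc m) (λ j → ℕtoℚ (suc m C j) * riemann N (λ x → ℕtoℚ (x ℕ.^ j)))
        ≡⟨ sumℚ-cong (suc m) (λ j _ → riemann-*ˡ N (ℕtoℚ (suc m C j)) _) ⟨
      sumℚ (suc m) (λ j → riemann N (λ x → ℕtoℚ (suc m C j) * ℕtoℚ (x ℕ.^ j)))
        ≡⟨ riemann-sum N (suc m) (λ j x → ℕtoℚ (suc m C j) * ℕtoℚ (x ℕ.^ j)) ⟨
      riemann N (λ x → sumℚ (suc m) (λ j → ℕtoℚ (suc m C j) * ℕtoℚ (x ℕ.^ j)))
        ≡⟨ cong (_* I) (sumℚ-cong M (λ x _ → binomial-Δ m x)) ⟩
      riemann N (λ x → ℕtoℚ (suc x ℕ.^ suc m) - ℕtoℚ (x ℕ.^ suc m))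
        ≡⟨ riemann-telescope N (λ x → ℕtoℚ (x ℕ.^ suc m)) ⟩
      (ℕtoℚ (M ℕ.^ suc m) - 0ℚ) * I
        ≡⟨ cong (λ t → (t - 0ℚ) * I) (ℕtoℚ-* M (M ℕ.^ m)) ⟩
      (ℕtoℚ M * ℕtoℚ (M ℕ.^ m) - 0ℚ) * I
        ≡⟨ solve 3 (λ a b i → (a :* b :- con 0ℚ) :* i := b :* (i :* a)) refl (ℕtoℚ M) (ℕtoℚ (M ℕ.^ m)) I ⟩
      ℕtoℚ (M ℕ.^ m) * (I * ℕtoℚ M)
        ≡⟨ cong (ℕtoℚ (M ℕ.^ m) *_) (1/n*n≡1 M {{ℕP.m^n≢0 p N}}) ⟩
      ℕtoℚ (M ℕ.^ m) * 1ℚ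
        ≡⟨ ℚP.*-identityʳ (ℕtoℚ (M ℕ.^ m)) ⟩
      ℕtoℚ (M ℕ.^ m) ∎
      where
      open ℚ-Solver
      M : ℕ
      M = p ℕ.^ N
      I : ℚ
      I = (+ 1 / M) {{ℕP.m^n≢0 p N}}

    integral-pow : ∀ m → HasIntegral (λ x → ℕtoℚ (x ℕ.^ m)) (B m)
    integral-pow = null-triangular (λ m j → ℕtoℚ (suc m C j)) (λ m → + 1 / suc m) error inverse null-row
      where
      error : ℕ → ℕ → ℚ
      error j N = riemann N (λ x → ℕtoℚ (x ℕ.^ j)) - B j
      inverse : ∀ m → (+ 1 / suc m) * ℕtoℚ (suc m C m) ≡ 1ℚ
      inverse m = trans (cong (λ c → (+ 1 / suc m) * ℕtoℚ c) ([m+1]Cm≡m+1 m)) (1/n*n≡1 (suc m))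
      row : ∀ m N → sumℚ (suc m) (λ j → ℕtoℚ (suc m C j) * error j N) ≡ ℕtoℚ ((p ℕ.^ N) ℕ.^ m) - isZero m
      row m N = begin
        sumℚ (suc m) (λ j → ℕtoℚ (suc m C j) * error j N)
          ≡⟨ sumℚ-cong (suc m) (λ j _ → distrib (ℕtoℚ (suc m C j)) _ (B j)) ⟩
        sumℚ (suc m) (λ j → ℕtoℚ (suc m C j) * riemann N (λ x → ℕtoℚ (x ℕ.^ j)) - ℕtoℚ (suc m C j) * B j)
          ≡⟨ sumℚ-- (suc m) (λ j → ℕtoℚ (suc m C j) * riemann N (λ x → ℕtoℚ (x ℕ.^ j))) (λ j → ℕtoℚ (suc m C j) * B j) ⟩
        sumℚ (suc m) (λ j → ℕtoℚ (suc m C j) * riemann N (λ x → ℕtoℚ (x ℕ.^ j))) - sumℚ (suc m) (λ j → ℕtoℚ (suc m C j) * B j)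
          ≡⟨ cong₂ _-_ (powerSum-recurrence m N) (bernoulli-recurrence m) ⟩
        ℕtoℚ ((p ℕ.^ N) ℕ.^ m) - isZero m ∎
        where
        open ℚ-Solver
        distrib : ∀ c r b → c * (r - b) ≡ c * r - c * b
        distrib = solve 3 (λ c r b → c :* (r :- b) := c :* r :- c :* b) refl
      null-row : ∀ m → Null (λ N → sumℚ (suc m) (λ j → ℕtoℚ (suc m C j) * error j N))
      null-row zero    = null-cong (λ N → trans (ℚP.+-inverseʳ 1ℚ) (sym (row 0 N))) null-zero
      null-row (suc m) = null-cong (λ N → trans (sym (ℚP.+-identityʳ (ℕtoℚ ((p ℕ.^ N) ℕ.^ suc m)))) (sym (row (suc m) N))) (null-pow m)

    volkenbornIntegralEq : ∀ f {L} → HasIntegral (λ x → ℕtoℚ (f x)) L → VolkenbornIntegralEq p pp f L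
    volkenbornIntegralEq f {L} = null-cong (λ N → cong (_- L) (sym (riemannSum≡riemann N)))
      where
      riemannSum≡riemann : ∀ N → riemannSum p pp N f ≡ riemann N (λ x → ℕtoℚ (f x))
      riemannSum≡riemann N = trans (/-as-* (+ sumℕ (p ℕ.^ N) f) (p ℕ.^ N) {{ℕP.m^n≢0 p N}})
                                   (cong (_* (+ 1 / p ℕ.^ N) {{ℕP.m^n≢0 p N}}) (ℕtoℚ-sumℕ (p ℕ.^ N) f))

  diffCoeff : ℕ → ℕ → ℕ → ℕ → ℚ
  diffCoeff n r k j = sgn j * ℕtoℚ (k C j) * ℕtoℚ (((k ∸ j) C n) ℕ.^ r)

  C^-newton : ∀ n r x → ℕtoℚ ((x C n) ℕ.^ r) ≡ sumℚ≤ (n ℕ.* r) (λ k → ℕtoℚ (x C k) * sumℚ≤ k (diffCoeff n r k))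
  C^-newton n r x = trans (newton-forward (suc (n ℕ.* r)) G (degreeBelow-C^ n r) x)
                          (sumℚ-cong (suc (n ℕ.* r)) (λ k _ → cong (ℕtoℚ (x C k) *_) (Δ^-alternating k G 0)))
    where
    G : ℕ → ℚ
    G x = ℕtoℚ ((x C n) ℕ.^ r)

  ^*C≡stirling : ∀ v x k → ℕtoℚ (x ℕ.^ v) * ℕtoℚ (x C k) ≡
                           sumℚ≤ k (λ l → ℤtoℚ (S₁ k l) * ℕtoℚ (x ℕ.^ (v ℕ.+ l)) * invFact k)
  ^*C≡stirling v x k = begin
    ℕtoℚ (x ℕ.^ v) * ℕtoℚ (x C k)                                         ≡⟨ cong (ℕtoℚ (x ℕ.^ v) *_) (C≡stirling x k) ⟩
    ℕtoℚ (x ℕ.^ v) * sumℚ≤ k (λ l → ℤtoℚ (S₁ k l) * ℕtoℚ (x ℕ.^ l) * invFact k)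
                                                                          ≡⟨ sumℚ-*ˡ (suc k) (ℕtoℚ (x ℕ.^ v)) _ ⟨
    sumℚ≤ k (λ l → ℕtoℚ (x ℕ.^ v) * (ℤtoℚ (S₁ k l) * ℕtoℚ (x ℕ.^ l) * invFact k))
                                                                          ≡⟨ sumℚ-cong (suc k) (λ l _ → absorb l) ⟩
    sumℚ≤ k (λ l → ℤtoℚ (S₁ k l) * ℕtoℚ (x ℕ.^ (v ℕ.+ l)) * invFact k)    ∎
    where
    absorb : ∀ l → ℕtoℚ (x ℕ.^ v) * (ℤtoℚ (S₁ k l) * ℕtoℚ (x ℕ.^ l) * invFact k) ≡
                   ℤtoℚ (S₁ k l) * ℕtoℚ (x ℕ.^ (v ℕ.+ l)) * invFact k
    absorb l = begin
      ℕtoℚ (x ℕ.^ v) * (ℤtoℚ (S₁ k l) * ℕtoℚ (x ℕ.^ l) * invFact k)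
        ≡⟨ solve 4 (λ a s b i → a :* (s :* b :* i) := s :* (a :* b) :* i) refl (ℕtoℚ (x ℕ.^ v)) (ℤtoℚ (S₁ k l)) (ℕtoℚ (x ℕ.^ l)) (invFact k) ⟩
      ℤtoℚ (S₁ k l) * (ℕtoℚ (x ℕ.^ v) * ℕtoℚ (x ℕ.^ l)) * invFact k
        ≡⟨ cong (λ t → ℤtoℚ (S₁ k l) * t * invFact k) (trans (cong ℕtoℚ (ℕP.^-distribˡ-+-* x v l)) (ℕtoℚ-* (x ℕ.^ v) (x ℕ.^ l))) ⟨
      ℤtoℚ (S₁ k l) * ℕtoℚ (x ℕ.^ (v ℕ.+ l)) * invFact k ∎
      where open ℚ-Solver

  integrand-expansion : ∀ n r v x → ℕtoℚ (x ℕ.^ v ℕ.* (x C n) ℕ.^ r) ≡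
    sumℚ≤ (n ℕ.* r) (λ k → sumℚ≤ k (λ j → diffCoeff n r k j *
      sumℚ≤ k (λ l → ℤtoℚ (S₁ k l) * ℕtoℚ (x ℕ.^ (v ℕ.+ l)) * invFact k)))
  integrand-expansion n r v x = begin
    ℕtoℚ (x ℕ.^ v ℕ.* (x C n) ℕ.^ r)
      ≡⟨ trans (ℕtoℚ-* (x ℕ.^ v) _) (cong (ℕtoℚ (x ℕ.^ v) *_) (C^-newton n r x)) ⟩
    ℕtoℚ (x ℕ.^ v) * sumℚ≤ (n ℕ.* r) (λ k → ℕtoℚ (x C k) * sumℚ≤ k (diffCoeff n r k))
      ≡⟨ sumℚ-*ˡ (suc (n ℕ.* r)) (ℕtoℚ (x ℕ.^ v)) _ ⟨
    sumℚ≤ (n ℕ.* r) (λ k → ℕtoℚ (x ℕ.^ v) * (ℕtoℚ (x C k) * sumℚ≤ k (diffCoeff n r k)))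
      ≡⟨ sumℚ-cong (suc (n ℕ.* r)) (λ k _ → term k) ⟩
    sumℚ≤ (n ℕ.* r) (λ k → sumℚ≤ k (λ j → diffCoeff n r k j * H k)) ∎
    where
    H : ℕ → ℚ
    H k = sumℚ≤ k (λ l → ℤtoℚ (S₁ k l) * ℕtoℚ (x ℕ.^ (v ℕ.+ l)) * invFact k)
    term : ∀ k → ℕtoℚ (x ℕ.^ v) * (ℕtoℚ (x C k) * sumℚ≤ k (diffCoeff n r k)) ≡ sumℚ≤ k (λ j → diffCoeff n r k j * H k)
    term k = begin
      ℕtoℚ (x ℕ.^ v) * (ℕtoℚ (x C k) * sumℚ≤ k (diffCoeff n r k))
        ≡⟨ solve 3 (λ a c s → a :* (c :* s) := s :* (a :* c)) refl (ℕtoℚ (x ℕ.^ v)) (ℕtoℚ (x C k)) (sumℚ≤ k (diffCoeff n r k)) ⟩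
      sumℚ≤ k (diffCoeff n r k) * (ℕtoℚ (x ℕ.^ v) * ℕtoℚ (x C k))
        ≡⟨ cong (sumℚ≤ k (diffCoeff n r k) *_) (^*C≡stirling v x k) ⟩
      sumℚ≤ k (diffCoeff n r k) * H k
        ≡⟨ sumℚ-*ʳ (suc k) (H k) (diffCoeff n r k) ⟨
      sumℚ≤ k (λ j → diffCoeff n r k j * H k) ∎
      where open ℚ-Solver

open import Defs
open import Data.Nat using (ℕ; suc; _^_; _*_; _+_)
open import Relation.Binary.PropositionalEquality using (_≢_; sym)
open import Data.Nat.Combinatorics using (_C_)
open import Data.Nat.Primality using (Prime)

mainTheorem5 : (p : ℕ) (pp : Prime p) → p ≢ 2 →
    (n r v : ℕ) →
    VolkenbornIntegralEq p pp (λ x → x ^ v * (x C n) ^ r) (rhs5 n r v)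
mainTheorem5 p pp _ n r v =
  volkenbornIntegralEq (λ x → x ^ v * (x C n) ^ r)
    (integral-cong (λ x → sym (integrand-expansion n r v x))
      (integral-sum (suc (n * r)) λ k →
        integral-sum (suc k) λ j →
          integral-*ˡ (diffCoeff n r k j)
            (integral-sum (suc k) λ l →
              integral-*ʳ (invFact k) (integral-*ˡ (ℤtoℚ (S₁ k l)) (integral-pow (v + l))))))
  where
  open Volkenborn p pp
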